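{- Let $\hat\tau$ be a constructor translation from a logic $\mathcal{L}''$ to a logic $\mathcal{L}'$, and assume $\mathcal{L}'$ is endowed with a strictly self-contained Gentzen calculus $\mathrm{G}_{\mathcal{L}'}$. Let $\varphi'\in F_{\mathcal{L}'}$ be such that $\vdash_{\mathcal{L}''\sqcup\mathcal{L}'}\varphi'$. Then $\vdash_{\mathcal{L}'}\varphi'$.
   Context: $\vdash_{\mathcal{L}'}\varphi$ means $\vdash_{\mathrm{G}_{\mathcal{L}'}}\ \to\varphi$ and $\vdash_{\mathcal{L}''\sqcup\mathcal{L}'}\varphi$ means $\vdash_{\mathrm{G}_{\mathcal{L}''\sqcup\mathcal{L}'}}\ \to\varphi$ (derivability of the sequent with empty antecedent). Syntax: a logic $\mathcal{L}$ has a signature $(C_{\mathcal{L},n})_{n\in\mathbb{N}}$ and a denumerable set $P_{\mathcal{L}}$ of propositional symbols; $F_{\mathcal{L}}$ is the set of formulas. $\mathcal{A}_{\mathcal{L}}$ is the collection of maps generated from $c^\bullet(\varphi_1,\dots,\varphi_n)=c(\varphi_1,\dots,\varphi_n)$ (0-ary constructors and propositional symbols as 0-argument maps) by composition, aggregation and projections. A constructor translation is an injective $\hat\tau:C_{\mathcal{L}''}\cup P_{\mathcal{L}''}\to\mathcal{A}_{\mathcal{L}'}$ sending $n$-ary constructors to $n$-argument maps, propositional symbols to 0-argument maps, 0-ary constructors to $c'^\bullet$ with $c'\in C_{\mathcal{L}',0}$, and such that for all $p'',q''\in P_{\mathcal{L}''}$ there are $p',q'\in P_{\mathcal{L}'}$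 with $p'$ occurring in $\hat\tau(p'')$ and $\hat\tau(q'')$ obtained from $\hat\tau(p'')$ replacing $p'$ by $q'$. $\tau$-identified symbols ($\hat\tau(c'')=c'^\bullet$) share the same name and are exactly the shared symbols. The combination $\mathcal{L}''\sqcup\mathcal{L}'$ has propositional symbols $P_{\mathcal{L}'}$ and constructors $C_0=C_{\mathcal{L}'',0}\cup C_{\mathcal{L}',0}\cup(P_{\mathcal{L}''}\setminus P_{\mathcal{L}'})$, $C_n=C_{\mathcal{L}'',n}\cup C_{\mathcal{L}',n}$. Gentzen calculi: a sequent is $\Gamma\to\Delta$ with finite multisets. Axioms are premise-free rules of forms $p,\Gamma\to\Delta,p$; $c_1(p),\Gamma\to\Delta,c_1(p)$; $\Gamma\to\Delta,p,c_1(p)$; $\bot,\Gamma\to\Delta$ ($p$ propositional symbol, $c_1$ unary, $\bot$ 0-ary). A left (right) rule for $c\in C_n$ has conclusion $c(\beta_1,\dots,\beta_n),\Gamma\to\Delta$ (resp. $\Gamma\to\Delta,c(\beta_1,\dots,\beta_n)$); a left (right) rule for $c_1c$ ($c_1$ unary) has conclusion $c_1(c(\beta_1,\dots,\beta_n)),\Gamma\to\Delta$ (resp. $\Gamma\to\Delta,c_1(c(\beta_1,\dots,\beta_n))$), and then there are no rules for $c_1$ alone. A rule is strictly self-contained if its premises contain only formulas among $\beta_1,\dots,\beta_n$ besides some $\Gamma'\subseteq\Gamma$, $\Delta'\subseteq\Delta$. A Gentzen calculus is a finite set of axioms and of left/right rules with the second axiom form present iff the third is; strictly self-contained if all its rules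 are. Instances replace metavariables by formulas; propositional symbols and constructors are fixed. A derivation of $\Psi\to\Lambda$ is a finite sequence of sequents starting with $\Psi\to\Lambda$, each an axiom instance or conclusion of a rule instance with premises occurring later. $\mathrm{G}_{\mathcal{L}''\sqcup\mathcal{L}'}$ consists of the axioms and rules of $\mathrm{G}_{\mathcal{L}'}$ (instantiated with combined formulas) plus: for $p''\in P_{\mathcal{L}''}$ (when $P_{\mathcal{L}''}\neq P_{\mathcal{L}'}$), from $\hat\tau(p''),\Gamma\to\Delta$ infer $p'',\Gamma\to\Delta$ and from $\Gamma\to\Delta,\hat\tau(p'')$ infer $\Gamma\to\Delta,p''$; for $c''\in C_{\mathcal{L}'',n}\setminus C_{\mathcal{L}',n}$, from $\hat\tau(c'')(\beta_1,\dots,\beta_n),\Gamma\to\Delta$ infer $c''(\beta_1,\dots,\beta_n),\Gamma\to\Delta$, and from $\Gamma\to\Delta,\hat\tau(c'')(\beta_1,\dots,\beta_n)$ infer $\Gamma\to\Delta,c''(\beta_1,\dots,\beta_n)$. -}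

module Defs where

open import Data.Nat using (ℕ; zero; suc)
open import Data.Fin using (Fin) renaming (zero to fzero; _<_ to _<ᶠ_)
open import Data.Vec using (Vec; []; _∷_; lookup; tabulate)
open import Data.List using (List; []; _∷_; map; _++_)
open import Data.List.Membership.Propositional using (_∈_)
open import Data.List.Relation.Unary.All using (All)
open import Data.List.Relation.Binary.Permutation.Propositional using (_↭_)
open import Data.Product using (Σ; Σ-syntax; _×_; _,_)
open import Data.Sum using (_⊎_; inj₁; inj₂; [_,_])
open import Data.Bool using (Bool; if_then_else_)
open import Relation.Nullary using (¬_)
open import Relation.Binary.PropositionalEquality using (_≡_; _≢_)
open import Function.Bundles using (_↔_)

data Tm (C : ℕ → Set) (V : Set) : Set where
  var : V → Tm C V
  con : ∀ {n} → C n → Vec (Tm C V) n → Tm C V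

module _ {C D : ℕ → Set} {V W : Set}
         (f : ∀ {n} → C n → D n) (σ : V → Tm D W) where
  mutual
    translate : Tm C V → Tm D W
    translate (var x)    = σ x
    translate (con c ts) = con (f c) (translates ts)

    translates : ∀ {n} → Vec (Tm C V) n → Vec (Tm D W) n
    translates []       = []
    translates (t ∷ ts) = translate t ∷ translates ts

record Logic : Set₁ where
  field
    Con         : ℕ → Set
    Prop        : Set
    denumerable : Prop ↔ ℕ

open Logic public

Formula : Logic → Set
Formula L = Tm (Con L) (Prop L)

-- n-argument maps of A_L: terms in the argument places Fin n
-- (generated by c^•, propositional symbols, composition, aggregation,
-- projections); a map is identified with the term denoting it.
Map : Logic → ℕ → Set
Map L n = Tm (Con L) (Prop L ⊎ Fin n)

bullet : ∀ {L n} → Con L n → Map L n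
bullet c = con c (tabulate (λ i → var (inj₂ i)))

module _ {C : ℕ → Set} {P X : Set} where
  mutual
    data Occurs (a : P) : Tm C (P ⊎ X) → Set where
      here  : Occurs a (var (inj₁ a))
      inArg : ∀ {n} {c : C n} {ts} → OccursV a ts → Occurs a (con c ts)

    data OccursV (a : P) : ∀ {n} → Vec (Tm C (P ⊎ X)) n → Set where
      hd : ∀ {n t} {ts : Vec _ n} → Occurs a t → OccursV a (t ∷ ts)
      tl : ∀ {n t} {ts : Vec _ n} → OccursV a ts → OccursV a (t ∷ ts)

  mutual
    data Replaced (a b : P) : Tm C (P ⊎ X) → Tm C (P ⊎ X) → Set where
      hit  : Replaced a b (var (inj₁ a)) (var (inj₁ b))
      miss : ∀ {r} → r ≢ a → Replaced a b (var (inj₁ r)) (var (inj₁ r))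
      arg  : ∀ {x} → Replaced a b (var (inj₂ x)) (var (inj₂ x))
      app  : ∀ {n} {c : C n} {ts us} → ReplacedV a b ts us →
             Replaced a b (con c ts) (con c us)

    data ReplacedV (a b : P) : ∀ {n} → Vec (Tm C (P ⊎ X)) n →
                               Vec (Tm C (P ⊎ X)) n → Set where
      []  : ReplacedV a b [] []
      _∷_ : ∀ {n t u} {ts us : Vec _ n} → Replaced a b t u →
            ReplacedV a b ts us → ReplacedV a b (t ∷ ts) (u ∷ us)

Symbol : Logic → Set
Symbol L = Σ ℕ (Con L) ⊎ Prop L

hat : ∀ {L'' L'} → (∀ {n} → Con L'' n → Map L' n) → (Prop L'' → Map L' 0) →
      Symbol L'' → Σ ℕ (Map L')
hat τC τP (inj₁ (n , c)) = n , τC c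
hat τC τP (inj₂ p)       = 0 , τP p

record ConstructorTranslation (L'' L' : Logic) : Set where
  field
    τC        : ∀ {n} → Con L'' n → Map L' n
    τP        : Prop L'' → Map L' 0
    injective : ∀ s t → hat {L''} {L'} τC τP s ≡ hat {L''} {L'} τC τP t → s ≡ t
    nullary   : ∀ (c : Con L'' 0) → Σ (Con L' 0) λ c' → τC c ≡ bullet {L'} c'
    uniform   : ∀ (p'' q'' : Prop L'') → Σ (Prop L') λ p' → Σ (Prop L') λ q' →
                Occurs p' (τP p'') × Replaced p' q' (τP p'') (τP q'')

Sequent : Set → Set
Sequent F = List F × List F      -- Γ → Δ, multisets represented as lists

_≈ₛ_ : ∀ {F} → Sequent F → Sequent F → Set
(Γ , Δ) ≈ₛ (Γ' , Δ') = (Γ ↭ Γ') × (Δ ↭ Δ')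

record System (F : Set) : Set₁ where
  field
    AxiomInst : Sequent F → Set
    RuleInst  : Sequent F → List (Sequent F) → Set

record Derivation {F : Set} (S : System F) (s : Sequent F) : Set where
  open System S
  field
    len   : ℕ
    seq   : Vec (Sequent F) (suc len)
    start : lookup seq fzero ≈ₛ s
    valid : ∀ i → AxiomInst (lookup seq i)
                ⊎ Σ (List (Sequent F)) λ prems →
                    RuleInst (lookup seq i) prems ×
                    All (λ pr → Σ (Fin (suc len)) λ j →
                                  (i <ᶠ j) × (lookup seq j ≈ₛ pr)) prems

⊢[_]_ : ∀ {F} → System F → F → Set
⊢[ S ] φ = Derivation S ([] , φ ∷ [])

data Side : Set where
  left right : Side

-- a rule is either for c ∈ C_n, or for c₁c with c₁ unary and c ∈ C_n
data Head (C : ℕ → Set) : ℕ → Set where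
  plain : ∀ {n} → C n → Head C n
  under : ∀ {n} → C 1 → C n → Head C n

-- a premise: schematic formulas (maps in the metavariables β₁..βₙ),
-- plus the context Γ (resp. Δ) if keepΓ (resp. keepΔ), otherwise empty
record PremiseSchema (L : Logic) (n : ℕ) : Set where
  constructor premise
  field
    keepΓ keepΔ : Bool
    ante succ   : List (Map L n)

record Rule (L : Logic) : Set where
  constructor rule
  field
    arity    : ℕ
    side     : Side
    head     : Head (Con L) arity
    premises : List (PremiseSchema L arity)

data Axiom (L : Logic) : Set where
  axId     : Axiom L               -- p, Γ → Δ, p
  axUnaryL : Con L 1 → Axiom L     -- c₁(p), Γ → Δ, c₁(p)
  axUnaryR : Con L 1 → Axiom L     -- Γ → Δ, p, c₁(p)
  axBot    : Con L 0 → Axiom L     -- ⊥, Γ → Δ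

data UnderOf {C : ℕ → Set} (c₁ : C 1) : ∀ {n} → Head C n → Set where
  isUnder : ∀ {n} {c : C n} → UnderOf c₁ (under c₁ c)

data PlainOf {C : ℕ → Set} (c₁ : C 1) : ∀ {n} → Head C n → Set where
  isPlain : PlainOf c₁ (plain c₁)

record GentzenCalculus (L : Logic) : Set where
  field
    axioms       : List (Axiom L)
    rules        : List (Rule L)
    unaryAxioms  : ∀ c₁ → (axUnaryL c₁ ∈ axioms → axUnaryR c₁ ∈ axioms)
                        × (axUnaryR c₁ ∈ axioms → axUnaryL c₁ ∈ axioms)
    noRuleAlone  : ∀ {r r'} → r ∈ rules → r' ∈ rules → ∀ c₁ →
                   UnderOf c₁ (Rule.head r) → ¬ PlainOf c₁ (Rule.head r')

open GentzenCalculus public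

data IsMeta {L : Logic} {n : ℕ} : Map L n → Set where
  meta : ∀ i → IsMeta (var (inj₂ i))

StrictlySelfContainedRule : ∀ {L} → Rule L → Set
StrictlySelfContainedRule {L} (rule n s h ps) =
  All (λ pr → All (IsMeta {L} {n}) (PremiseSchema.ante pr) ×
              All (IsMeta {L} {n}) (PremiseSchema.succ pr)) ps

StrictlySelfContained : ∀ {L} → GentzenCalculus L → Set
StrictlySelfContained G = All StrictlySelfContainedRule (rules G)

-- instances of the axioms and rules of a calculus for L, with formulas in a
-- language Tm D (Prop L) containing the constructors of L via e
module Instances (L : Logic) {D : ℕ → Set} (e : ∀ {n} → Con L n → D n) where
  F : Set
  F = Tm D (Prop L)

  inst : ∀ {n} → Map L n → Vec F n → F
  inst t βs = translate e [ var , lookup βs ] t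

  headInst : ∀ {n} → Head (Con L) n → Vec F n → F
  headInst (plain c)    βs = con (e c) βs
  headInst (under c₁ c) βs = con (e c₁) (con (e c) βs ∷ [])

  premInst : ∀ {n} → PremiseSchema L n → Vec F n → List F → List F → Sequent F
  premInst (premise kΓ kΔ a s) βs Γ Δ =
    (map (λ t → inst t βs) a ++ (if kΓ then Γ else [])) ,
    (map (λ t → inst t βs) s ++ (if kΔ then Δ else []))

  conclusion : (r : Rule L) → Vec F (Rule.arity r) → List F → List F → Sequent F
  conclusion (rule n left  h ps) βs Γ Δ = (headInst h βs ∷ Γ) , Δ
  conclusion (rule n right h ps) βs Γ Δ = Γ , (headInst h βs ∷ Δ)

  RuleInstance : Rule L → Sequent F → List (Sequent F) → Set
  RuleInstance r s prems =
    Σ (Vec F (Rule.arity r)) λ βs → Σ (List F) λ Γ → Σ (List F) λ Δ →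
      (s ≈ₛ conclusion r βs Γ Δ) ×
      (prems ≡ map (λ pr → premInst pr βs Γ Δ) (Rule.premises r))

  AxiomInstance : Axiom L → Sequent F → Set
  AxiomInstance axId s =
    Σ (Prop L) λ p → Σ (List F) λ Γ → Σ (List F) λ Δ →
      s ≈ₛ ((var p ∷ Γ) , (var p ∷ Δ))
  AxiomInstance (axUnaryL c₁) s =
    Σ (Prop L) λ p → Σ (List F) λ Γ → Σ (List F) λ Δ →
      s ≈ₛ ((con (e c₁) (var p ∷ []) ∷ Γ) , (con (e c₁) (var p ∷ []) ∷ Δ))
  AxiomInstance (axUnaryR c₁) s =
    Σ (Prop L) λ p → Σ (List F) λ Γ → Σ (List F) λ Δ →
      s ≈ₛ (Γ , (var p ∷ con (e c₁) (var p ∷ []) ∷ Δ))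
  AxiomInstance (axBot b) s =
    Σ (List F) λ Γ → Σ (List F) λ Δ →
      s ≈ₛ ((con (e b) [] ∷ Γ) , Δ)

  IsAxiomInstance : GentzenCalculus L → Sequent F → Set
  IsAxiomInstance G s = Σ (Axiom L) λ a → (a ∈ axioms G) × AxiomInstance a s

  IsRuleInstance : GentzenCalculus L → Sequent F → List (Sequent F) → Set
  IsRuleInstance G s prems = Σ (Rule L) λ r → (r ∈ rules G) × RuleInstance r s prems

GSystem : (L : Logic) → GentzenCalculus L → System (Formula L)
GSystem L G = record
  { AxiomInst = IsAxiomInstance G
  ; RuleInst  = IsRuleInstance G }
  where open Instances L (λ c → c)

⊢⟨_,_⟩_ : (L : Logic) → GentzenCalculus L → Formula L → Set
⊢⟨ L , G ⟩ φ = ⊢[ GSystem L G ] φ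

module Combination {L'' L' : Logic} (τ : ConstructorTranslation L'' L') where
  open ConstructorTranslation τ

  -- c'' is τ-identified with some c' (hence shared)
  Identified : ∀ {n} → Con L'' n → Set
  Identified {n} c = Σ (Con L' n) λ c' → τC c ≡ bullet {L'} c'

  IdentifiedP : Prop L'' → Set
  IdentifiedP p = Σ (Prop L') λ p' → τP p ≡ var (inj₁ p')

  -- constructors of L'' ⊔ L': C_{L',n} ∪ C_{L'',n} (shared symbols
  -- counted once), and in arity 0 also P_{L''} \ P_{L'}
  data CCon : ℕ → Set where
    old  : ∀ {n} → Con L' n → CCon n
    new  : ∀ {n} (c : Con L'' n) → .(¬ Identified c) → CCon n
    newP : (p : Prop L'') → .(¬ IdentifiedP p) → CCon 0

  CFormula : Set
  CFormula = Tm CCon (Prop L')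

  embed : Formula L' → CFormula
  embed = translate old var

  open Instances L' old public
    renaming (IsAxiomInstance to CAxiom; IsRuleInstance to CRule; inst to cinst)

  data TransRule : Sequent CFormula → List (Sequent CFormula) → Set where
    propL  : ∀ p .(np : ¬ IdentifiedP p) Γ Δ s →
             s ≈ₛ ((con (newP p np) [] ∷ Γ) , Δ) →
             TransRule s (((cinst (τP p) [] ∷ Γ) , Δ) ∷ [])
    propR  : ∀ p .(np : ¬ IdentifiedP p) Γ Δ s →
             s ≈ₛ (Γ , (con (newP p np) [] ∷ Δ)) →
             TransRule s ((Γ , (cinst (τP p) [] ∷ Δ)) ∷ [])
    conL   : ∀ {n} (c : Con L'' n) .(nc : ¬ Identified c) (βs : Vec CFormula n) Γ Δ s →
             s ≈ₛ ((con (new c nc) βs ∷ Γ) , Δ) →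
             TransRule s (((cinst (τC c) βs ∷ Γ) , Δ) ∷ [])
    conR   : ∀ {n} (c : Con L'' n) .(nc : ¬ Identified c) (βs : Vec CFormula n) Γ Δ s →
             s ≈ₛ (Γ , (con (new c nc) βs ∷ Δ)) →
             TransRule s ((Γ , (cinst (τC c) βs ∷ Δ)) ∷ [])

  CSystem : GentzenCalculus L' → System CFormula
  CSystem G = record
    { AxiomInst = CAxiom G
    ; RuleInst  = λ s prems → CRule G s prems ⊎ TransRule s prems }

  ⊢⊔⟨_⟩_ : GentzenCalculus L' → CFormula → Set
  ⊢⊔⟨ G ⟩ φ = ⊢[ CSystem G ] φ

{-# OPTIONS --safe #-}
-- Every formula of L'' ⊔ L' desugars to a formula of L' by replacing each new
-- symbol c'' by τ̂(c''). Desugaring commutes with instantiating L'-schemata, so it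
-- maps instances of the axioms and rules of G_{L'} to instances of the same axioms
-- and rules, while it identifies the conclusion and the premise of every
-- translation rule. Desugaring a derivation sequent by sequent, and letting each
-- translation step inherit the justification of its premise, gives a
-- G_{L'}-derivation of the desugared endsequent, which for φ' ∈ F_{L'} is → φ'.
module Submission where

open import Defs
open import Data.Nat using (suc)
open import Data.Fin using (Fin) renaming (zero to fzero; suc to fsuc; _<_ to _<ᶠ_; _>_ to _>ᶠ_)
open import Data.Fin.Properties using (<-trans)
open import Data.Fin.Induction using (>-wellFounded)
open import Induction.WellFounded using (Acc; acc)
open import Data.Vec using (Vec; []; _∷_; lookup)
import Data.Vec as Vec
open import Data.Vec.Properties using (lookup-map)
open import Data.List using (List; []; _∷_; map; _++_)
open import Data.List.Properties using (map-++; map-∘; map-cong)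
open import Data.List.Relation.Unary.All using (All; []; _∷_)
import Data.List.Relation.Unary.All as All
import Data.List.Relation.Unary.All.Properties as Allₚ
open import Data.List.Relation.Binary.Permutation.Propositional using (↭-refl; ↭-sym; ↭-trans)
open import Data.List.Relation.Binary.Permutation.Propositional.Properties using (map⁺)
open import Data.Product using (Σ; _×_; _,_)
open import Data.Sum using (_⊎_; inj₁; inj₂; [_,_])
open import Data.Bool using (Bool; if_then_else_)
open import Data.Bool.Properties using (if-float)
open import Function using (_∘_)
open import Relation.Binary.PropositionalEquality using (_≡_; refl; sym; trans; cong; cong₂; subst)

mutual
  translate-id : ∀ {C V} (t : Tm C V) → translate (λ c → c) var t ≡ t
  translate-id (var x)    = refl
  translate-id (con c ts) = cong (con c) (translates-id ts)

  translates-id : ∀ {C V n} (ts : Vec (Tm C V) n) → translates (λ c → c) var ts ≡ ts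
  translates-id []       = refl
  translates-id (t ∷ ts) = cong₂ _∷_ (translate-id t) (translates-id ts)

≈ₛ-refl : ∀ {F} {s : Sequent F} → s ≈ₛ s
≈ₛ-refl = ↭-refl , ↭-refl

≈ₛ-sym : ∀ {F} {s t : Sequent F} → s ≈ₛ t → t ≈ₛ s
≈ₛ-sym (p , q) = ↭-sym p , ↭-sym q

≈ₛ-trans : ∀ {F} {s t u : Sequent F} → s ≈ₛ t → t ≈ₛ u → s ≈ₛ u
≈ₛ-trans (p , q) (p' , q') = ↭-trans p p' , ↭-trans q q'

≡⇒≈ₛ : ∀ {F} {s t : Sequent F} → s ≡ t → s ≈ₛ t
≡⇒≈ₛ refl = ≈ₛ-refl

module _ {F : Set} (S : System F) where
  open System S

  Justified : ∀ {n} → (Fin n → Sequent F) → Fin n → Set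
  Justified {n} σ i =
    AxiomInst (σ i)
    ⊎ Σ (List (Sequent F)) λ prems →
        RuleInst (σ i) prems ×
        All (λ pr → Σ (Fin n) λ j → (i <ᶠ j) × (σ j ≈ₛ pr)) prems

  record Respects≈ₛ : Set where
    field
      axiom-≈ : ∀ {s t} → s ≈ₛ t → AxiomInst t → AxiomInst s
      rule-≈  : ∀ {s t prems} → s ≈ₛ t → RuleInst t prems → RuleInst s prems

  module _ (resp : Respects≈ₛ) where
    open Respects≈ₛ resp

    Justified-resp : ∀ {n} {σ σ' : Fin n → Sequent F} → (∀ k → σ' k ≈ₛ σ k) →
                     ∀ {i} → Justified σ i → Justified σ' i
    Justified-resp σ'≈σ (inj₁ ax) = inj₁ (axiom-≈ (σ'≈σ _) ax)
    Justified-resp σ'≈σ (inj₂ (prems , ri , later)) =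
      inj₂ (prems , rule-≈ (σ'≈σ _) ri ,
            All.map (λ { (j , i<j , e) → j , i<j , ≈ₛ-trans (σ'≈σ j) e }) later)

    Justified-earlier : ∀ {n} {σ : Fin n → Sequent F} {i j} → i <ᶠ j → σ i ≈ₛ σ j →
                        Justified σ j → Justified σ i
    Justified-earlier i<j e (inj₁ ax) = inj₁ (axiom-≈ e ax)
    Justified-earlier i<j e (inj₂ (prems , ri , later)) =
      inj₂ (prems , rule-≈ e ri ,
            All.map (λ { (k , j<k , e') → k , <-trans i<j j<k , e' }) later)

GSystem-respects≈ₛ : ∀ {L} (G : GentzenCalculus L) → Respects≈ₛ (GSystem L G)
GSystem-respects≈ₛ {L} G = record
  { axiom-≈ = λ { e (a , a∈ , ai) → a , a∈ , axiomInstance-≈ a e ai }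
  ; rule-≈  = λ { e (r , r∈ , (βs , Γ , Δ , e' , eq)) →
                    r , r∈ , (βs , Γ , Δ , ≈ₛ-trans e e' , eq) }
  }
  where
    open Instances L (λ c → c)

    axiomInstance-≈ : ∀ a {s t} → s ≈ₛ t → AxiomInstance a t → AxiomInstance a s
    axiomInstance-≈ axId         e (p , Γ , Δ , e') = p , Γ , Δ , ≈ₛ-trans e e'
    axiomInstance-≈ (axUnaryL c) e (p , Γ , Δ , e') = p , Γ , Δ , ≈ₛ-trans e e'
    axiomInstance-≈ (axUnaryR c) e (p , Γ , Δ , e') = p , Γ , Δ , ≈ₛ-trans e e'
    axiomInstance-≈ (axBot b)    e (Γ , Δ , e')     = Γ , Δ , ≈ₛ-trans e e'

Collapses : ∀ {F F'} → (Sequent F → Sequent F') → Sequent F → List (Sequent F) → Set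
Collapses f s prems = Σ (Sequent _) λ pr → (prems ≡ pr ∷ []) × (f s ≈ₛ f pr)

record Simulation {F F'} (S : System F) (T : System F') (f : Sequent F → Sequent F') : Set where
  field
    map-≈     : ∀ {s t} → s ≈ₛ t → f s ≈ₛ f t
    map-axiom : ∀ {s} → System.AxiomInst S s → System.AxiomInst T (f s)
    map-rule  : ∀ {s prems} → System.RuleInst S s prems →
                System.RuleInst T (f s) (map f prems) ⊎ Collapses f s prems

map-derivation : ∀ {F F'} {S : System F} {T : System F'} {f : Sequent F → Sequent F'} →
                 Respects≈ₛ T → Simulation S T f → ∀ {s} → Derivation S s → Derivation T (f s)
map-derivation {S = S} {T} {f} resp sim d = record
  { len   = len
  ; seq   = Vec.map f seq
  ; start = ≈ₛ-trans (≡⇒≈ₛ (lookup-map fzero f seq)) (map-≈ start)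
  ; valid = λ i → Justified-resp T resp (λ k → ≡⇒≈ₛ (lookup-map k f seq))
                                        (justify i (>-wellFounded i))
  }
  where
    open Derivation d
    open Simulation sim

    -- Recursion towards the end of the sequence: a collapsing step inherits the
    -- justification of its premise, which occurs later.
    justify : ∀ i → Acc _>ᶠ_ i → Justified T (f ∘ lookup seq) i
    justify i (acc later) = simulateStep (valid i)
      where
        simulateRule : ∀ {prems} →
                       System.RuleInst T (f (lookup seq i)) (map f prems)
                         ⊎ Collapses f (lookup seq i) prems →
                       All (λ pr → Σ (Fin (suc len)) λ j → (i <ᶠ j) × (lookup seq j ≈ₛ pr)) prems →
                       Justified T (f ∘ lookup seq) i
        simulateRule (inj₁ ri) prems-later =
          inj₂ (_ , ri ,
                Allₚ.map⁺ (All.map (λ { (j , i<j , e) → j , i<j , map-≈ e }) prems-later))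
        simulateRule (inj₂ (pr , refl , e)) ((j , i<j , e') ∷ []) =
          Justified-earlier T resp i<j (≈ₛ-trans e (≈ₛ-sym (map-≈ e'))) (justify j (later i<j))

        simulateStep : Justified S (lookup seq) i → Justified T (f ∘ lookup seq) i
        simulateStep (inj₁ ax)                          = inj₁ (map-axiom ax)
        simulateStep (inj₂ (prems , ri , prems-later)) = simulateRule (map-rule ri) prems-later

module Desugaring {L'' L' : Logic} (τ : ConstructorTranslation L'' L') where
  open ConstructorTranslation τ
  open Combination τ
  module G' = Instances L' (λ c → c)

  mutual
    desugar : CFormula → Formula L'
    desugar (var p)             = var p
    desugar (con (old c) ts)    = con c (desugars ts)
    desugar (con (new c _) ts)  = G'.inst (τC c) (desugars ts)
    desugar (con (newP p _) []) = G'.inst (τP p) []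

    desugars : ∀ {n} → Vec CFormula n → Vec (Formula L') n
    desugars []       = []
    desugars (t ∷ ts) = desugar t ∷ desugars ts

  desugar-lookup : ∀ {n} (βs : Vec CFormula n) i →
                   desugar (lookup βs i) ≡ lookup (desugars βs) i
  desugar-lookup (β ∷ βs) fzero    = refl
  desugar-lookup (β ∷ βs) (fsuc i) = desugar-lookup βs i

  mutual
    desugar-translate : ∀ {X} {σ : X → CFormula} {σ' : X → Formula L'} →
                        (∀ x → desugar (σ x) ≡ σ' x) →
                        ∀ t → desugar (translate old σ t) ≡ translate (λ c → c) σ' t
    desugar-translate σ≈σ' (var x)    = σ≈σ' x
    desugar-translate σ≈σ' (con c ts) = cong (con c) (desugars-translates σ≈σ' ts)

    desugars-translates : ∀ {X n} {σ : X → CFormula} {σ' : X → Formula L'} →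
                          (∀ x → desugar (σ x) ≡ σ' x) →
                          ∀ (ts : Vec (Tm (Con L') X) n) →
                          desugars (translates old σ ts) ≡ translates (λ c → c) σ' ts
    desugars-translates σ≈σ' []       = refl
    desugars-translates σ≈σ' (t ∷ ts) =
      cong₂ _∷_ (desugar-translate σ≈σ' t) (desugars-translates σ≈σ' ts)

  desugar-embed : ∀ φ → desugar (embed φ) ≡ φ
  desugar-embed φ = trans (desugar-translate (λ _ → refl) φ) (translate-id φ)

  desugar-cinst : ∀ {n} (t : Map L' n) βs → desugar (cinst t βs) ≡ G'.inst t (desugars βs)
  desugar-cinst t βs = desugar-translate desugar-argument t
    where
      desugar-argument : ∀ x → desugar ([ var , lookup βs ] x) ≡ [ var , lookup (desugars βs) ] x
      desugar-argument (inj₁ p) = refl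
      desugar-argument (inj₂ i) = desugar-lookup βs i

  desugarₛ : Sequent CFormula → Sequent (Formula L')
  desugarₛ (Γ , Δ) = map desugar Γ , map desugar Δ

  desugarₛ-≈ : ∀ {s t} → s ≈ₛ t → desugarₛ s ≈ₛ desugarₛ t
  desugarₛ-≈ (p , q) = map⁺ desugar p , map⁺ desugar q

  desugar-instances : ∀ {n} (ts : List (Map L' n)) βs →
                      map desugar (map (λ t → cinst t βs) ts) ≡
                      map (λ t → G'.inst t (desugars βs)) ts
  desugar-instances ts βs = trans (sym (map-∘ ts)) (map-cong (λ t → desugar-cinst t βs) ts)

  desugar-premiseSide : ∀ {n} (ts : List (Map L' n)) βs (keep : Bool) (Θ : List CFormula) →
                        map desugar (map (λ t → cinst t βs) ts ++ (if keep then Θ else [])) ≡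
                        map (λ t → G'.inst t (desugars βs)) ts ++ (if keep then map desugar Θ else [])
  desugar-premiseSide ts βs keep Θ =
    trans (map-++ desugar (map (λ t → cinst t βs) ts) (if keep then Θ else []))
          (cong₂ _++_ (desugar-instances ts βs) (if-float (map desugar) keep))

  desugar-premInst : ∀ {n} (pr : PremiseSchema L' n) βs Γ Δ →
                     desugarₛ (premInst pr βs Γ Δ) ≡
                     G'.premInst pr (desugars βs) (map desugar Γ) (map desugar Δ)
  desugar-premInst (premise kΓ kΔ a s) βs Γ Δ =
    cong₂ _,_ (desugar-premiseSide a βs kΓ Γ) (desugar-premiseSide s βs kΔ Δ)

  desugar-conclusion : ∀ (r : Rule L') βs Γ Δ →
                       desugarₛ (conclusion r βs Γ Δ) ≡
                       G'.conclusion r (desugars βs) (map desugar Γ) (map desugar Δ)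
  desugar-conclusion (rule n left  (plain c)    ps) βs Γ Δ = refl
  desugar-conclusion (rule n left  (under c₁ c) ps) βs Γ Δ = refl
  desugar-conclusion (rule n right (plain c)    ps) βs Γ Δ = refl
  desugar-conclusion (rule n right (under c₁ c) ps) βs Γ Δ = refl

  desugar-axiomInstance : ∀ a {s} → AxiomInstance a s → G'.AxiomInstance a (desugarₛ s)
  desugar-axiomInstance axId         (p , Γ , Δ , e) = p , _ , _ , desugarₛ-≈ e
  desugar-axiomInstance (axUnaryL c) (p , Γ , Δ , e) = p , _ , _ , desugarₛ-≈ e
  desugar-axiomInstance (axUnaryR c) (p , Γ , Δ , e) = p , _ , _ , desugarₛ-≈ e
  desugar-axiomInstance (axBot b)    (Γ , Δ , e)     = _ , _ , desugarₛ-≈ e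

  desugar-ruleInstance : ∀ r {s prems} → RuleInstance r s prems →
                         G'.RuleInstance r (desugarₛ s) (map desugarₛ prems)
  desugar-ruleInstance r {s} (βs , Γ , Δ , e , refl) =
    desugars βs , map desugar Γ , map desugar Δ ,
    subst (desugarₛ s ≈ₛ_) (desugar-conclusion r βs Γ Δ) (desugarₛ-≈ e) ,
    trans (sym (map-∘ (Rule.premises r)))
          (map-cong (λ pr → desugar-premInst pr βs Γ Δ) (Rule.premises r))

  collapse-left : ∀ {s φ ψ Γ Δ} → s ≈ₛ ((φ ∷ Γ) , Δ) → desugar φ ≡ desugar ψ →
                  Collapses desugarₛ s (((ψ ∷ Γ) , Δ) ∷ [])
  collapse-left {s} {Γ = Γ} {Δ} e φ≡ψ =
    _ , refl , subst (λ χ → desugarₛ s ≈ₛ ((χ ∷ map desugar Γ) , map desugar Δ))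
                     φ≡ψ (desugarₛ-≈ e)

  collapse-right : ∀ {s φ ψ Γ Δ} → s ≈ₛ (Γ , (φ ∷ Δ)) → desugar φ ≡ desugar ψ →
                   Collapses desugarₛ s ((Γ , (ψ ∷ Δ)) ∷ [])
  collapse-right {s} {Γ = Γ} {Δ} e φ≡ψ =
    _ , refl , subst (λ χ → desugarₛ s ≈ₛ (map desugar Γ , (χ ∷ map desugar Δ)))
                     φ≡ψ (desugarₛ-≈ e)

  transRule-collapses : ∀ {s prems} → TransRule s prems → Collapses desugarₛ s prems
  transRule-collapses (propL p _ _ _ _ e)   = collapse-left  e (sym (desugar-cinst (τP p) []))
  transRule-collapses (propR p _ _ _ _ e)   = collapse-right e (sym (desugar-cinst (τP p) []))
  transRule-collapses (conL c _ βs _ _ _ e) = collapse-left  e (sym (desugar-cinst (τC c) βs))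
  transRule-collapses (conR c _ βs _ _ _ e) = collapse-right e (sym (desugar-cinst (τC c) βs))

  desugar-simulation : (G : GentzenCalculus L') → Simulation (CSystem G) (GSystem L' G) desugarₛ
  desugar-simulation G = record
    { map-≈     = desugarₛ-≈
    ; map-axiom = λ { (a , a∈ , ai) → a , a∈ , desugar-axiomInstance a ai }
    ; map-rule  = λ { (inj₁ (r , r∈ , ri)) → inj₁ (r , r∈ , desugar-ruleInstance r ri)
                    ; (inj₂ tr)            → inj₂ (transRule-collapses tr) }
    }

mainTheorem7 : (L'' L' : Logic) (τ : ConstructorTranslation L'' L')
               (G : GentzenCalculus L') → StrictlySelfContained G →
               (φ' : Formula L') →
               Combination.⊢⊔⟨_⟩_ τ G (Combination.embed τ φ') →
               ⊢⟨ L' , G ⟩ φ'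
mainTheorem7 L'' L' τ G _ φ' ⊢φ' =
  subst (⊢⟨ L' , G ⟩_) (desugar-embed φ')
        (map-derivation (GSystem-respects≈ₛ G) (desugar-simulation G) ⊢φ')
  where open Desugaring τ
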